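{- Let $\mathcal M=(U,\mathcal L)$ be a COM, $S\in\mathrm{Samp}(\mathcal M)$, $X'$ a lower covector for $S$, and $X\in\mathcal L$ an upper covector for $S$ with $X\setminus S^0=X'$. Then $\mathrm{Sep}(S,X)=\varnothing$ and $\mathrm{vcd}(X)\ge\mathrm{vcd}(X')$. Furthermore, if $\mathrm{vcd}(X)=\mathrm{vcd}(X')$, then $\widehat{\widehat S}=(X\circ S)\setminus\underline X$ is a full sample of $\mathcal M(X)$.
   Context: Sign vectors $X:U\to\{ -1,0,+1\}$, support $\underline X$, zero set $X^0$, $(X\circ Y)_e=X_e$ if $X_e\ne0$ else $Y_e$, $\mathrm{Sep}(X,Y)=\{e:X_eY_e=-1\}$, $X\le Y$ iff $X_e\in\{0,Y_e\}$ for all $e$; $X\setminus A$ is the restriction to $U\setminus A$. A COM $\mathcal M=(U,\mathcal L)$ is $\mathcal L\subseteq\{ -1,0,+1\}^U$ satisfying (FS) $X\circ(-Y)\in\mathcal L$ and (SE) for $e\in\mathrm{Sep}(X,Y)$ some $Z\in\mathcal L$ has $Z_e=0$, $Z_f=(X\circ Y)_f$ for $f\notin\mathrm{Sep}(X,Y)$; assumed simple. Topes are maximal elements of $(\mathcal L,\le)$. Deletion $\mathcal M\setminus A=(U\setminus A,\{Y\setminus A:Y\in\mathcal L\})$ (a COM); for a covector $Y$ of a COM $\mathcal N$, $\mathcal N(Y)=\mathcal N\setminus\underline Y$. VC-dimension of a COM: maximum size of $D$ such that each $Z\in\{\pm1\}^D$ is the restriction of a tope; $\mathrm{vcd}(X)=\mathrm{vcd}(\mathcal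 M(X))$ and, for a covector $X'$ of $\mathcal M'$, $\mathrm{vcd}(X')=\mathrm{vcd}(\mathcal M'(X'))$. $\mathrm{Samp}(\mathcal M)=\{S:S\le T$ for some tope $T\}$. For $S\in\mathrm{Samp}(\mathcal M)$, let $\mathcal M'=\mathcal M\setminus S^0$ and $T'=S\setminus S^0$ (a tope of $\mathcal M'$). A lower covector for $S$ is any minimal nonzero covector $X'$ of $\mathcal M'$ with $X'\le T'$; an upper covector for $S$ is any $X\in\mathcal L$ with $X\setminus S^0=X'$ for a lower covector $X'$. A sample $Q$ of a COM $\mathcal N$ is full if $\mathcal N\setminus Q^0$ has the same VC-dimension as $\mathcal N$. -}

module Defs where

open import Data.Nat using (ℕ; _≤_)
open import Data.Bool using (Bool; true; false; if_then_else_)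
open import Data.Fin using (Fin)
open import Data.Fin.Subset using (Subset; _∈_; ∣_∣)
open import Data.Vec using (Vec; lookup; zipWith; map; replicate)
open import Data.Product using (Σ; ∃; _×_; _,_)
open import Data.Sum using (_⊎_)
open import Relation.Nullary using (¬_)
open import Relation.Binary.PropositionalEquality using (_≡_)
open import Level using (Level; suc; zero)

data Sign : Set where
  neg zer pos : Sign

SignVec : ℕ → Set
SignVec n = Vec Sign n

negS : Sign → Sign
negS neg = pos
negS zer = zer
negS pos = neg

-_ᵛ : ∀ {n} → SignVec n → SignVec n
- X ᵛ = map negS X

compS : Sign → Sign → Sign
compS zer b = b
compS a   _ = a

_⊙_ : ∀ {n} → SignVec n → SignVec n → SignVec n
X ⊙ Y = zipWith compS X Y

isZero : Sign → Bool
isZero zer = true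
isZero _   = false

nonZero : Sign → Bool
nonZero zer = false
nonZero _   = true

zeroSet : ∀ {n} → SignVec n → Subset n
zeroSet X = map isZero X

supp : ∀ {n} → SignVec n → Subset n
supp X = map nonZero X

zeroVec : ∀ {n} → SignVec n
zeroVec = replicate _ zer

SepAt : ∀ {n} → SignVec n → SignVec n → Fin n → Set
SepAt X Y e = (lookup X e ≡ pos × lookup Y e ≡ neg) ⊎ (lookup X e ≡ neg × lookup Y e ≡ pos)

_≤ₛ_ : Sign → Sign → Set
a ≤ₛ b = (a ≡ zer) ⊎ (a ≡ b)

_≼_ : ∀ {n} → SignVec n → SignVec n → Set
X ≼ Y = ∀ e → lookup X e ≤ₛ lookup Y e

SVS : ℕ → Set₁
SVS n = SignVec n → Set

-- Restriction X \ A, encoded on the same ground set by setting the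
-- coordinates in A to 0 (isomorphic to restricting to U \ A).
restrict : ∀ {n} → Subset n → SignVec n → SignVec n
restrict A X = zipWith (λ b s → if b then zer else s) A X

del : ∀ {n} → SVS n → Subset n → SVS n
del L A Z = ∃ λ Y → L Y × Z ≡ restrict A Y

Simple : ∀ {n} → SVS n → Set
Simple {n} L =
  (∀ e → ∃ λ X → L X × ¬ (lookup X e ≡ zer)) ×
  (∀ e f → ¬ (e ≡ f) →
     (∃ λ X → L X × ¬ (lookup X e ≡ lookup X f)) ×
     (∃ λ X → L X × ¬ (lookup X e ≡ negS (lookup X f))))

record IsCOM {n} (L : SVS n) : Set where
  field
    FS     : ∀ X Y → L X → L Y → L (X ⊙ (- Y ᵛ))
    SE     : ∀ X Y → L X → L Y → ∀ e → SepAt X Y e →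
               ∃ λ Z → L Z × lookup Z e ≡ zer ×
                 (∀ f → ¬ SepAt X Y f → lookup Z f ≡ lookup (X ⊙ Y) f)
    simple : Simple L

Tope : ∀ {n} → SVS n → SignVec n → Set
Tope L T = L T × (∀ Y → L Y → T ≼ Y → Y ≡ T)

toSign : Bool → Sign
toSign true  = pos
toSign false = neg

Shatters : ∀ {n} → SVS n → Subset n → Set
Shatters L D = ∀ (z : Vec Bool _) → ∃ λ T → Tope L T ×
                 (∀ e → e ∈ D → lookup T e ≡ toSign (lookup z e))

IsVCDim : ∀ {n} → SVS n → ℕ → Set
IsVCDim L d = (∃ λ D → Shatters L D × ∣ D ∣ ≡ d) × (∀ D → Shatters L D → ∣ D ∣ ≤ d)

loc : ∀ {n} → SVS n → SignVec n → SVS n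
loc L Y = del L (supp Y)

Samp : ∀ {n} → SVS n → SignVec n → Set
Samp L S = ∃ λ T → Tope L T × S ≼ T

LowerCov : ∀ {n} → SVS n → SignVec n → SignVec n → Set
LowerCov L S X' =
  let L' = del L (zeroSet S) in
  L' X' × ¬ (X' ≡ zeroVec) × X' ≼ restrict (zeroSet S) S ×
  (∀ Y → L' Y → ¬ (Y ≡ zeroVec) → Y ≼ X' → Y ≡ X')

FullSample : ∀ {n} → SVS n → SignVec n → Set
FullSample N Q = Samp N Q ×
  (∀ d d' → IsVCDim N d → IsVCDim (del N (zeroSet Q)) d' → d ≡ d')

-- Since X' = X \ S⁰ lies below S \ S⁰, X agrees with S wherever S is nonzero, so S and X
-- are not separated. Both 𝓜'(X') and 𝓜(X) \ Q⁰ (where Q is the new sample) arise from 𝓜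
-- by deleting supp X ∪ S⁰, so they are the same system. Topes have full support (the COM
-- is simple), hence composing any covector with a tope T₀ gives a tope; therefore a set
-- shattered after deleting supp X ∪ S⁰ is already shattered after deleting supp X alone.
-- This gives vcd(X') ≤ vcd(X), and equality says exactly that Q is full for 𝓜(X).
module Submission where

open import Defs
open import Data.Nat using (ℕ; _≤_)
open import Data.Product using (∃; _×_)
open import Relation.Nullary using (¬_)
open import Relation.Binary.PropositionalEquality using (_≡_)

open import Data.Bool using (true; false; if_then_else_; _∨_)
open import Data.Bool.Properties using (∨-identityʳ; ∨-zeroʳ)
open import Data.Empty using (⊥-elim)
open import Data.Fin using (zero; suc)
open import Data.Fin.Subset using (Subset; _∪_)
open import Data.Nat.Properties using (≤-antisym)
open import Data.Product using (_,_; proj₁; proj₂)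
open import Data.Sum using (_⊎_; inj₁; inj₂)
open import Data.Vec using ([]; _∷_; lookup)
open import Data.Vec.Properties using (lookup-zipWith)
open import Relation.Binary.PropositionalEquality using (_≢_; refl; sym; trans; cong; cong₂; subst; module ≡-Reasoning)
open import Relation.Unary using (_≐_)
open import Relation.Unary.Properties using (≐-sym; ≐-trans)

private
  variable
    n : ℕ

≤ₛ-trans : ∀ {a b c} → a ≤ₛ b → b ≤ₛ c → a ≤ₛ c
≤ₛ-trans (inj₁ a≡0) _ = inj₁ a≡0
≤ₛ-trans (inj₂ refl) b≤c = b≤c

≤ₛ-nonzero : ∀ {a b} → a ≢ zer → a ≤ₛ b → b ≡ a
≤ₛ-nonzero a≢0 (inj₁ a≡0) = ⊥-elim (a≢0 a≡0)
≤ₛ-nonzero _ (inj₂ refl) = refl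

toSign≢zer : ∀ b → toSign b ≢ zer
toSign≢zer true ()
toSign≢zer false ()

compS-nonzero : ∀ a {b} → b ≢ zer → compS a b ≢ zer
compS-nonzero neg _ ()
compS-nonzero zer b≢0 = b≢0
compS-nonzero pos _ ()

≼-∷ : ∀ {a b} {X Y : SignVec n} → a ≤ₛ b → X ≼ Y → (a ∷ X) ≼ (b ∷ Y)
≼-∷ a≤b _   zero    = a≤b
≼-∷ _   X≼Y (suc e) = X≼Y e

≼-⊙ : ∀ (X Y : SignVec n) → X ≼ (X ⊙ Y)
≼-⊙ [] [] ()
≼-⊙ (x ∷ X) (y ∷ Y) = ≼-∷ (head x) (≼-⊙ X Y)
  where
  head : ∀ x → x ≤ₛ compS x y
  head neg = inj₂ refl
  head zer = inj₁ refl
  head pos = inj₂ refl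

⊙-nonzero : ∀ (X T : SignVec n) → (∀ e → lookup T e ≢ zer) → ∀ e → lookup (X ⊙ T) e ≢ zer
⊙-nonzero X T T≢0 e eq =
  compS-nonzero (lookup X e) (T≢0 e) (trans (sym (lookup-zipWith compS e X T)) eq)

restrict-∪-≼ : ∀ (A B : Subset n) (Y : SignVec n) → restrict (A ∪ B) Y ≼ restrict A Y
restrict-∪-≼ [] [] [] ()
restrict-∪-≼ (true  ∷ A) (b ∷ B) (y ∷ Y) = ≼-∷ (inj₁ refl) (restrict-∪-≼ A B Y)
restrict-∪-≼ (false ∷ A) (b ∷ B) (y ∷ Y) = ≼-∷ (head b) (restrict-∪-≼ A B Y)
  where
  head : ∀ b → (if b then zer else y) ≤ₛ y
  head true  = inj₁ refl
  head false = inj₂ refl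

restrict-mono : ∀ (A : Subset n) {X Y : SignVec n} → X ≼ Y → restrict A X ≼ restrict A Y
restrict-mono [] {[]} {[]} _ ()
restrict-mono (true  ∷ A) {_ ∷ X} {_ ∷ Y} X≼Y = ≼-∷ (inj₁ refl) (restrict-mono A (λ e → X≼Y (suc e)))
restrict-mono (false ∷ A) {_ ∷ X} {_ ∷ Y} X≼Y = ≼-∷ (X≼Y zero) (restrict-mono A (λ e → X≼Y (suc e)))

restrict-restrict : ∀ (A B : Subset n) (Y : SignVec n) → restrict B (restrict A Y) ≡ restrict (B ∪ A) Y
restrict-restrict [] [] [] = refl
restrict-restrict (a ∷ A) (true  ∷ B) (y ∷ Y) = cong (zer ∷_) (restrict-restrict A B Y)
restrict-restrict (a ∷ A) (false ∷ B) (y ∷ Y) = cong (_ ∷_) (restrict-restrict A B Y)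

restrict-supp-⊙ : ∀ (X Y : SignVec n) → restrict (supp X) (X ⊙ Y) ≡ restrict (supp X) Y
restrict-supp-⊙ [] [] = refl
restrict-supp-⊙ (x ∷ X) (y ∷ Y) = cong₂ _∷_ (head x) (restrict-supp-⊙ X Y)
  where
  head : ∀ x → (if nonZero x then zer else compS x y) ≡ (if nonZero x then zer else y)
  head neg = refl
  head zer = refl
  head pos = refl

supp-restrict-∪ : ∀ (A : Subset n) (X : SignVec n) → supp (restrict A X) ∪ A ≡ supp X ∪ A
supp-restrict-∪ [] [] = refl
supp-restrict-∪ (true  ∷ A) (x ∷ X) = cong₂ _∷_ (sym (∨-zeroʳ (nonZero x))) (supp-restrict-∪ A X)
supp-restrict-∪ (false ∷ A) (x ∷ X) = cong (_ ∷_) (supp-restrict-∪ A X)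

zeroSet-restrict-supp-⊙ : ∀ (X S : SignVec n) →
  zeroSet (restrict (supp X) (X ⊙ S)) ∪ supp X ≡ supp X ∪ zeroSet S
zeroSet-restrict-supp-⊙ [] [] = refl
zeroSet-restrict-supp-⊙ (x ∷ X) (s ∷ S) = cong₂ _∷_ (head x) (zeroSet-restrict-supp-⊙ X S)
  where
  head : ∀ x → isZero (if nonZero x then zer else compS x s) ∨ nonZero x ≡ nonZero x ∨ isZero s
  head neg = refl
  head zer = ∨-identityʳ (isZero s)
  head pos = refl

⊙-⊙-negate : ∀ (X Y : SignVec n) → X ⊙ (- (X ⊙ (- Y ᵛ)) ᵛ) ≡ X ⊙ Y
⊙-⊙-negate [] [] = refl
⊙-⊙-negate (x ∷ X) (y ∷ Y) = cong₂ _∷_ (head x y) (⊙-⊙-negate X Y)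
  where
  head : ∀ x y → compS x (negS (compS x (negS y))) ≡ compS x y
  head neg y   = refl
  head pos y   = refl
  head zer neg = refl
  head zer zer = refl
  head zer pos = refl

module _ {L : SVS n} (com : IsCOM L) where
  open IsCOM com

  ⊙-closed : ∀ {X Y} → L X → L Y → L (X ⊙ Y)
  ⊙-closed {X} {Y} LX LY = subst L (⊙-⊙-negate X Y) (FS X (X ⊙ (- Y ᵛ)) LX (FS X Y LX LY))

  -- A tope T satisfies T ⊙ Y ≡ T by maximality, and simplicity provides a Y nonzero at e.
  tope-nonzero : ∀ {T} → Tope L T → ∀ e → lookup T e ≢ zer
  tope-nonzero {T} (LT , maximal) e Tₑ≡0 with proj₁ simple e
  ... | Y , LY , Yₑ≢0 = Yₑ≢0 (begin
    lookup Y e                          ≡⟨ cong (λ t → compS t (lookup Y e)) Tₑ≡0 ⟨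
    compS (lookup T e) (lookup Y e)     ≡⟨ lookup-zipWith compS e T Y ⟨
    lookup (T ⊙ Y) e                    ≡⟨ cong (λ V → lookup V e) (maximal (T ⊙ Y) (⊙-closed LT LY) (≼-⊙ T Y)) ⟩
    lookup T e                          ≡⟨ Tₑ≡0 ⟩
    zer                                 ∎)
    where open ≡-Reasoning

tope-del : ∀ {L : SVS n} (A : Subset n) {V} → L V → (∀ e → lookup V e ≢ zer) → Tope (del L A) (restrict A V)
tope-del {L = L} A {V} LV V≢0 = (V , LV , refl) , maximal
  where
  restrict-maximal : ∀ {m} (A : Subset m) (V Y : SignVec m) → (∀ e → lookup V e ≢ zer) →
    restrict A V ≼ restrict A Y → restrict A Y ≡ restrict A V
  restrict-maximal [] [] [] _ _ = refl
  restrict-maximal (true  ∷ A) (v ∷ V) (y ∷ Y) V≢0 le =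
    cong (zer ∷_) (restrict-maximal A V Y (λ e → V≢0 (suc e)) (λ e → le (suc e)))
  restrict-maximal (false ∷ A) (v ∷ V) (y ∷ Y) V≢0 le =
    cong₂ _∷_ (≤ₛ-nonzero (V≢0 zero) (le zero)) (restrict-maximal A V Y (λ e → V≢0 (suc e)) (λ e → le (suc e)))
  maximal : ∀ Z → del L A Z → restrict A V ≼ Z → Z ≡ restrict A V
  maximal _ (Y , _ , refl) = restrict-maximal A V Y V≢0

del-del : ∀ (L : SVS n) (A B : Subset n) → del (del L A) B ≐ del L (B ∪ A)
del-del L A B = (λ { (_ , (Y , LY , refl) , refl) → Y , LY , restrict-restrict A B Y })
              , (λ { (Y , LY , refl) → restrict A Y , (Y , LY , refl) , sym (restrict-restrict A B Y) })

module _ {P R : SVS n} (P≐R : P ≐ R) where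

  tope-≐ : ∀ {T} → Tope P T → Tope R T
  tope-≐ (PT , maximal) = proj₁ P≐R PT , λ Y RY → maximal Y (proj₂ P≐R RY)

  shatters-≐ : ∀ {D} → Shatters P D → Shatters R D
  shatters-≐ shatter z with shatter z
  ... | T , tope-T , agree = T , tope-≐ tope-T , agree

isVCDim-≐ : ∀ {P R : SVS n} → P ≐ R → ∀ {d} → IsVCDim P d → IsVCDim R d
isVCDim-≐ P≐R ((D , shatter , ∣D∣≡d) , bound) =
  (D , shatters-≐ P≐R shatter , ∣D∣≡d) , λ D′ shatter′ → bound D′ (shatters-≐ (≐-sym P≐R) shatter′)

isVCDim-unique : ∀ {P : SVS n} {d d′} → IsVCDim P d → IsVCDim P d′ → d ≡ d′
isVCDim-unique ((D , shatter , refl) , bound) ((D′ , shatter′ , refl) , bound′) =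
  ≤-antisym (bound′ D shatter) (bound D′ shatter′)

-- A tope restrict (A ∪ B) Y of the larger deletion lies below the tope restrict A (Y ⊙ T₀).
shatters-del-∪ : ∀ {L : SVS n} → IsCOM L → ∀ {T₀} → Tope L T₀ → ∀ (A B : Subset n) {D} →
  Shatters (del L (A ∪ B)) D → Shatters (del L A) D
shatters-del-∪ com {T₀} tope-T₀@(LT₀ , _) A B shatter z with shatter z
... | _ , ((Y , LY , refl) , _) , agree =
  restrict A (Y ⊙ T₀) ,
  tope-del A (⊙-closed com LY LT₀) (⊙-nonzero Y T₀ (tope-nonzero com tope-T₀)) ,
  λ e e∈D → trans (≤ₛ-nonzero (T-nonzero-on-D e e∈D) (below e)) (agree e e∈D)
  where
  below : restrict (A ∪ B) Y ≼ restrict A (Y ⊙ T₀)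
  below e = ≤ₛ-trans (restrict-∪-≼ A B Y e) (restrict-mono A (≼-⊙ Y T₀) e)
  T-nonzero-on-D : ∀ e e∈D → lookup (restrict (A ∪ B) Y) e ≢ zer
  T-nonzero-on-D e e∈D eq = toSign≢zer _ (trans (sym (agree e e∈D)) eq)

≼-off-zeroSet⇒¬Sep : ∀ (S X : SignVec n) → restrict (zeroSet S) X ≼ restrict (zeroSet S) S → ∀ e → ¬ SepAt S X e
≼-off-zeroSet⇒¬Sep (s ∷ S) (x ∷ X) X≼S zero    = λ sep → separated-≰ sep (X≼S zero)
  where
  separated-≰ : ∀ {s x} → (s ≡ pos × x ≡ neg) ⊎ (s ≡ neg × x ≡ pos) →
    ¬ (if isZero s then zer else x) ≤ₛ (if isZero s then zer else s)
  separated-≰ (inj₁ (refl , refl)) (inj₁ ())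
  separated-≰ (inj₁ (refl , refl)) (inj₂ ())
  separated-≰ (inj₂ (refl , refl)) (inj₁ ())
  separated-≰ (inj₂ (refl , refl)) (inj₂ ())
≼-off-zeroSet⇒¬Sep (s ∷ S) (x ∷ X) X≼S (suc e) = ≼-off-zeroSet⇒¬Sep S X (λ e → X≼S (suc e)) e

lemma25 : ∀ {n} (L : SVS n) → IsCOM L → (S : SignVec n) → Samp L S →
    (X' : SignVec n) → LowerCov L S X' →
    (X : SignVec n) → L X → restrict (zeroSet S) X ≡ X' →
    (∀ e → ¬ SepAt S X e) ×
    (∀ d d' → IsVCDim (loc L X) d → IsVCDim (loc (del L (zeroSet S)) X') d' → d' ≤ d) ×
    ((∃ λ d → IsVCDim (loc L X) d × IsVCDim (loc (del L (zeroSet S)) X') d) →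
      FullSample (loc L X) (restrict (supp X) (X ⊙ S)))
lemma25 L com S (T₀ , tope-T₀@(LT₀ , _) , S≼T₀) _ (_ , _ , X'≼S , _) X _ refl =
  ≼-off-zeroSet⇒¬Sep S X X'≼S ,
  (λ { _ _ (_ , bound) ((D , shatter , refl) , _) →
         bound D (shatters-del-∪ com tope-T₀ (supp X) (zeroSet S) (shatters-≐ 𝓜'X'≐ shatter)) }) ,
  λ { (_ , vcd-X , vcd-X') →
        Q-sample , λ d₁ d₂ vcd₁ vcd₂ → trans (isVCDim-unique vcd₁ vcd-X)
                                            (isVCDim-unique (isVCDim-≐ 𝓜'X'≐𝓜X∖Q⁰ vcd-X') vcd₂) }
  where
  X' = restrict (zeroSet S) X
  Q = restrict (supp X) (X ⊙ S)

  𝓜'X'≐ : loc (del L (zeroSet S)) X' ≐ del L (supp X ∪ zeroSet S)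
  𝓜'X'≐ = subst (λ A → loc (del L (zeroSet S)) X' ≐ del L A) (supp-restrict-∪ (zeroSet S) X)
                (del-del L (zeroSet S) (supp X'))

  𝓜X∖Q⁰≐ : del (loc L X) (zeroSet Q) ≐ del L (supp X ∪ zeroSet S)
  𝓜X∖Q⁰≐ = subst (λ A → del (loc L X) (zeroSet Q) ≐ del L A) (zeroSet-restrict-supp-⊙ X S)
                 (del-del L (supp X) (zeroSet Q))

  𝓜'X'≐𝓜X∖Q⁰ : loc (del L (zeroSet S)) X' ≐ del (loc L X) (zeroSet Q)
  𝓜'X'≐𝓜X∖Q⁰ = ≐-trans 𝓜'X'≐ (≐-sym 𝓜X∖Q⁰≐)

  Q-sample : Samp (loc L X) Q
  Q-sample = restrict (supp X) T₀ , tope-del (supp X) LT₀ (tope-nonzero com tope-T₀) ,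
             subst (_≼ restrict (supp X) T₀) (sym (restrict-supp-⊙ X S)) (restrict-mono (supp X) S≼T₀)
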